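{- Let $\mathfrak S=(S,F,\leq)$ be an $\infty$-effective complete WSTS and $s_0\in S$. If the procedure $\mathbf{Clover}_{\mathfrak S}$ terminates on $s_0$, then $(\mathfrak S,s_0)$ is strongly clover-flattable.
   Context: Poset notions: ${\downarrow}$ downward closure, $\mathrm{Max}$ maximal elements, directed sets, dcpo, continuous dcpo, wpo (every infinite sequence has $i<j$ with $x_i\leq x_j$), dcwo = dcpo + wpo; Scott-open sets, closed sets (complements), closure $cl$; $\mathrm{Lub}(E)=\{\bigvee D\mid D\subseteq E\text{ directed}\}$. A complete WSTS (also: complete transition system) is $(S,F,\leq)$ with $(S,\leq)$ a continuous dcwo and $F$ a finite set of partial continuous maps (Scott-open domain, preserving directed suprema inside the domain). $F^*$: finite compositions (words over $F$). $Post_{\mathfrak S}(A)=\{f(a)\mid f\in F,a\in A\cap\mathrm{dom}f\}$; $Cover_{\mathfrak S}(s_0)={\downarrow}Post^*_{\mathfrak S}({\downarrow}s_0)$. $A\leq^\flat B$ iff ${\downarrow}A\subseteq{\downarrow}B$. Lub-acceleration: $g^\infty(x)=\bigvee_ng^n(x)$ if $x<g(x)$, else $g(x)$. $\infty$-effective: coded states, decidable $\leq$, computable maps with decidable domains, computable $g^\infty$ for each $g\in F^*$. Procedure $\mathbf{Clover}_{\mathfrak S}(s_0)$: $A\leftarrow\{s_0\}$; while $Post_{\mathfrak S}(A)\not\leq^\flat A$, choose fairly $(g,a)\in F^*\times A$ with $a\in\mathrm{dom}\,g$ and set $A\leftarrow A\cup\{g^\infty(a)\}$; return $\mathrm{Max}\,A$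 (fairness: on every infinite execution, every pair $(g,a)$ with $a$ in the current $A$ and $a\in\mathrm{dom}\,g$ is eventually picked). An rl-automaton over $F$ is a DFA $\mathcal A=(F,Q,\delta,q_0)$ with partial transition function, all of whose states are final, recognizing $\mathrm{Pfx}(w_1^*\cdots w_k^*)$ (set of prefixes) for some $w_1,\dots,w_k\in F^*$. The synchronized product $\mathfrak S\times\mathcal A$ has states $S\times Q$ ordered by $(s,q)\leq(s',q')$ iff $s\leq s'$ and $q=q'$, and transitions given by the maps $(s,q)\mapsto(f(s),\delta(q,f))$ ($s\in\mathrm{dom}f$, $\delta(q,f)$ defined), $f\in F$; $\pi_1(s,q)=s$. $(\mathfrak S,s_0)$ is strongly clover-flattable iff there is an rl-automaton $\mathcal A$ with initial state $q_0$ such that $cl(Cover_{\mathfrak S}(s_0))=cl(\pi_1\langle cl(Cover_{\mathfrak S\times\mathcal A}(s_0,q_0))\rangle)$. -}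

module Defs where

open import Level using (Level; _⊔_; 0ℓ) renaming (suc to lsuc)
open import Data.Nat using (ℕ) renaming (_<_ to _<ℕ_)
open import Data.Fin using (Fin)
open import Data.Maybe using (Maybe; just; nothing; _>>=_)
open import Data.List using (List; []; _∷_; _++_; concat; replicate)
open import Data.List.Membership.Propositional using (_∈_)
open import Data.Product using (Σ; ∃; ∃-syntax; _×_; _,_)
open import Relation.Nullary using (¬_; Dec)
open import Relation.Binary.PropositionalEquality using (_≡_; _≢_)
open import Relation.Binary.Structures using (IsPartialOrder)
open import Function.Bundles using (_⇔_)

module Order {T : Set} (_≤_ : T → T → Set) where

  Down : ∀ {ℓ} → (T → Set ℓ) → T → Set ℓ
  Down A x = ∃[ y ] (A y × x ≤ y)

  _≤♭_ : ∀ {ℓ ℓ'} → (T → Set ℓ) → (T → Set ℓ') → Set (ℓ ⊔ ℓ')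
  A ≤♭ B = ∀ x → Down A x → Down B x

  Directed : ∀ {ℓ} → (T → Set ℓ) → Set ℓ
  Directed D = (∃[ x ] D x)
             × (∀ x y → D x → D y → ∃[ z ] (D z × x ≤ z × y ≤ z))

  IsLub : ∀ {ℓ} → (T → Set ℓ) → T → Set ℓ
  IsLub D x = (∀ d → D d → d ≤ x)
            × (∀ u → (∀ d → D d → d ≤ u) → x ≤ u)

  ScottOpen : (T → Set) → Set₁
  ScottOpen U = (∀ x y → U x → x ≤ y → U y)
              × (∀ (D : T → Set) → Directed D → ∀ z → IsLub D z → U z →
                   ∃[ d ] (D d × U d))

  ScottClosed : (T → Set) → Set₁
  ScottClosed C = ∃[ U ] (ScottOpen U × (∀ x → C x ⇔ (¬ U x)))

  cl : ∀ {ℓ} → (T → Set ℓ) → T → Set (lsuc 0ℓ ⊔ ℓ)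
  cl A x = ∀ (C : T → Set) → ScottClosed C → (∀ y → A y → C y) → C x

  _≪_ : T → T → Set₁
  x ≪ y = ∀ (D : T → Set) → Directed D → ∀ z → IsLub D z → y ≤ z →
            ∃[ d ] (D d × x ≤ d)

  _≐_ : ∀ {ℓ ℓ'} → (T → Set ℓ) → (T → Set ℓ') → Set (ℓ ⊔ ℓ')
  A ≐ B = (∀ x → A x → B x) × (∀ x → B x → A x)

-- Transition systems with n labelled partial maps T → Maybe T.
-- (Labels Fin n stand for the elements of the finite set F.)

module Trans {T : Set} (_≤_ : T → T → Set) {n : ℕ} (step : Fin n → T → Maybe T) where
  open Order _≤_

  stepW : List (Fin n) → T → Maybe T
  stepW []      x = just x
  stepW (f ∷ w) x = step f x >>= stepW w

  Post : ∀ {ℓ} → (T → Set ℓ) → T → Set ℓ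
  Post A y = ∃[ f ] ∃[ a ] (A a × step f a ≡ just y)

  data PostStar {ℓ} (A : T → Set ℓ) : T → Set ℓ where
    base : ∀ {x} → A x → PostStar A x
    next : ∀ {x y} (f : Fin n) → PostStar A x → step f x ≡ just y → PostStar A y

  Cover : T → T → Set
  Cover s₀ = Down (PostStar (Down (λ x → x ≡ s₀)))

record CompleteWSTS : Set₁ where
  field
    S      : Set
    _≤_    : S → S → Set
    isPartialOrder : IsPartialOrder _≡_ _≤_
  open Order _≤_ public
  field
    dcpo       : ∀ (D : S → Set) → Directed D → ∃[ x ] IsLub D x
    continuous : ∀ y → Directed (λ x → x ≪ y) × IsLub (λ x → x ≪ y) y
    wpo        : ∀ (x : ℕ → S) → ∃[ i ] ∃[ j ] (i <ℕ j × x i ≤ x j)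
    n          : ℕ
    step       : Fin n → S → Maybe S
    domOpen    : ∀ f → ScottOpen (λ x → ∃[ y ] (step f x ≡ just y))
    stepCont   : ∀ f (D : S → Set) → Directed D →
                   (∀ d → D d → ∃[ y ] (step f d ≡ just y)) →
                   ∀ z → IsLub D z →
                   ∃[ y ] (step f z ≡ just y ×
                           IsLub (λ u → ∃[ d ] (D d × step f d ≡ just u)) y)
  open Trans _≤_ step public

  _⊏_ : S → S → Set
  x ⊏ y = x ≤ y × x ≢ y

  -- Lub-acceleration, as a relation: Accel g x y  means  x ∈ dom g and y = g^∞(x)
  Accel : List (Fin n) → S → S → Set
  Accel g x y = ∃[ gx ] (stepW g x ≡ just gx
              × (x ⊏ gx → IsLub (λ z → ∃[ k ] (stepW (concat (replicate k g)) x ≡ just z)) y)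
              × (¬ (x ⊏ gx) → y ≡ gx))

-- ∞-effectiveness (maps are Agda functions, hence computable, and
-- domains dom f = {x | step f x ≠ nothing} are decidable)

record InfEffective (𝔖 : CompleteWSTS) : Set where
  open CompleteWSTS 𝔖
  field
    ≤-dec   : ∀ x y → Dec (x ≤ y)
    acc     : List (Fin n) → S → S
    acc-spec : ∀ g x → ∃[ y ] (stepW g x ≡ just y) → Accel g x (acc g x)

module _ (𝔖 : CompleteWSTS) where
  open CompleteWSTS 𝔖

  data CloverRun (s₀ : S) : List S → Set where
    start : CloverRun s₀ (s₀ ∷ [])
    extend : ∀ {A} → CloverRun s₀ A →
             ¬ (Post (λ x → x ∈ A) ≤♭ (λ x → x ∈ A)) →
             (g : List (Fin n)) (a y : S) → a ∈ A → Accel g a y →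
             CloverRun s₀ (y ∷ A)

  CloverTerminates : S → Set
  CloverTerminates s₀ = ∃[ A ] (CloverRun s₀ A × (Post (λ x → x ∈ A) ≤♭ (λ x → x ∈ A)))

module _ {n : ℕ} where

  data InStar (w : List (Fin n)) : List (Fin n) → Set where
    nil  : InStar w []
    cons : ∀ {u} → InStar w u → InStar w (w ++ u)

  data InStars : List (List (Fin n)) → List (Fin n) → Set where
    nil  : InStars [] []
    cons : ∀ {w ws u v} → InStar w u → InStars ws v → InStars (w ∷ ws) (u ++ v)

  Pfx : (List (Fin n) → Set) → List (Fin n) → Set
  Pfx L w = ∃[ u ] L (w ++ u)

δ* : ∀ {m n} → (Fin m → Fin n → Maybe (Fin m)) → Fin m → List (Fin n) → Maybe (Fin m)
δ* δ q []      = just q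
δ* δ q (f ∷ w) = δ q f >>= λ q' → δ* δ q' w

-- rl-automaton: partial DFA over F, all states final, recognizing
-- Pfx(w₁* ⋯ wₖ*) where words = w₁ ∷ … ∷ wₖ ∷ []
record RlAutomaton (n : ℕ) : Set where
  field
    m  : ℕ
    δ  : Fin m → Fin n → Maybe (Fin m)
    q₀ : Fin m
    words      : List (List (Fin n))
    recognizes : ∀ w → (∃[ q ] (δ* δ q₀ w ≡ just q)) ⇔ Pfx (InStars words) w

module _ (𝔖 : CompleteWSTS) where
  open CompleteWSTS 𝔖

  module Product (𝒜 : RlAutomaton n) where
    open RlAutomaton 𝒜

    _≤×_ : S × Fin m → S × Fin m → Set
    (s , q) ≤× (s' , q') = s ≤ s' × q ≡ q'

    step× : Fin n → S × Fin m → Maybe (S × Fin m)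
    step× f (s , q) = step f s >>= λ s' → δ q f >>= λ q' → just (s' , q')

    open Order _≤×_ public using () renaming (cl to cl×)
    open Trans _≤×_ step× public using () renaming (Cover to Cover×)

  StronglyCloverFlattable : S → Set₁
  StronglyCloverFlattable s₀ =
    ∃[ 𝒜 ] (let open RlAutomaton 𝒜 ; open Product 𝒜 in
      cl (Cover s₀) ≐ cl (λ s → ∃[ q ] cl× (Cover× (s₀ , q₀)) (s , q)))

module Submission where

-- Let a terminating Clover execution from s₀ end with the finite set A,
-- and let w₁, …, wₖ be the words it accelerated, in order.  We take the
-- rl-automaton 𝒜 for Pfx(w₁* ⋯ wₖ*).  With Reach the set of states
-- reachable from s₀ along words of w₁* ⋯ wₖ*, we show
--   cl(Cover(s₀)) ⊆ cl(Reach) ⊆ cl(π₁⟨cl(Cover_{𝔖×𝒜}(s₀ , q₀))⟩),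
-- while the reverse inclusion holds for every rl-automaton.

open import Defs
open import Data.Nat using (ℕ; zero; suc; _^_; _⊔_; _≤′_; ≤′-refl; ≤′-step)
import Data.Nat.Properties as ℕ
open import Data.Fin using (Fin; funToFin; finToFun)
open import Data.Fin.Patterns using (0F; 1F)
import Data.Fin.Properties as Fin
open import Data.Maybe using (Maybe; just; nothing; _>>=_)
open import Data.Maybe.Properties using (just-injective)
open import Data.List using (List; []; _∷_; _++_; map; length; lookup; concat; replicate)
import Data.List.Properties as List
open import Data.List.Membership.Propositional using (_∈_)
open import Data.List.Membership.Propositional.Properties using (∈-map⁺; ∈-map⁻; ∈-++⁺ˡ; ∈-++⁺ʳ; ∈-++⁻)
open import Data.List.Relation.Unary.Any using (here; there; index)
open import Data.List.Relation.Unary.Any.Properties using (lookup-index)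
import Data.Product.Properties as Pair
open import Data.Product using (∃; ∃-syntax; _×_; _,_; proj₁; proj₂)
open import Data.Sum using (_⊎_; inj₁; inj₂)
open import Data.Unit using (⊤; tt)
open import Data.Empty using (⊥-elim)
open import Relation.Nullary using (¬_; Dec; yes; no)
open import Relation.Nullary.Decidable using (_×-dec_)
open import Relation.Binary.Definitions using (DecidableEquality)
open import Relation.Binary.Structures using (IsPartialOrder)
open import Relation.Binary.PropositionalEquality using (_≡_; refl; sym; trans; cong; subst; subst₂; module ≡-Reasoning)
open import Function using (id)
open import Function.Bundles using (_⇔_; mk⇔; Equivalence)
import Function.Properties.Equivalence as ⇔

module BoundedLanguages {n : ℕ} where

  Word : Set
  Word = List (Fin n)

  InStars-[] : ∀ (ws : List Word) → InStars ws []
  InStars-[] []       = nil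
  InStars-[] (w ∷ ws) = cons nil (InStars-[] ws)

  InStars-++ : ∀ {ws vs : List Word} {u v} → InStars ws u → InStars vs v → InStars (ws ++ vs) (u ++ v)
  InStars-++ nil J = J
  InStars-++ (cons {u = u₁} {v = v₁} i I) J
    = subst (InStars _) (sym (List.++-assoc u₁ v₁ _)) (cons i (InStars-++ I J))

  InStars-repeat : ∀ {w : Word} {ws v} → InStars (w ∷ ws) v → InStars (w ∷ ws) (w ++ v)
  InStars-repeat {w} (cons {u = u} {v = v} i I) =
    subst (InStars _) (List.++-assoc w u v) (cons (cons i) I)

  pow : Word → ℕ → Word
  pow g k = concat (replicate k g)

  InStar-pow : ∀ g k → InStar g (pow g k)
  InStar-pow g zero    = nil
  InStar-pow g (suc k) = cons (InStar-pow g k)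

  pow-suc : ∀ g k → pow g (suc k) ≡ pow g k ++ g
  pow-suc g zero    = List.++-identityʳ g
  pow-suc g (suc k) = trans (cong (g ++_) (pow-suc g k)) (sym (List.++-assoc g (pow g k) g))

  InStar-head : ∀ {w y : Word} {f x} → InStar w y → y ≡ f ∷ x →
                ∃[ r ] ∃[ u ] (w ≡ f ∷ r × x ≡ r ++ u × InStar w u)
  InStar-head nil ()
  InStar-head {[]}    (cons i) eq = InStar-head i eq
  InStar-head {f ∷ r} (cons {u} i) refl = r , u , refl , refl , i

suffixes : ∀ {A : Set} → List A → List (List A)
suffixes []       = [] ∷ []
suffixes (x ∷ xs) = (x ∷ xs) ∷ suffixes xs

suffixes-self : ∀ {A : Set} (xs : List A) → xs ∈ suffixes xs
suffixes-self []       = here refl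
suffixes-self (x ∷ xs) = here refl

suffixes-[] : ∀ {A : Set} (xs : List A) → [] ∈ suffixes xs
suffixes-[] []       = here refl
suffixes-[] (x ∷ xs) = there (suffixes-[] xs)

suffixes-tail : ∀ {A : Set} {x : A} {xs} ys → x ∷ xs ∈ suffixes ys → xs ∈ suffixes ys
suffixes-tail []       (here ())
suffixes-tail []       (there ())
suffixes-tail (y ∷ ys) (here refl) = there (suffixes-self ys)
suffixes-tail (y ∷ ys) (there m)   = there (suffixes-tail ys m)

-- A run of the NFA with successor function succs reads w from c; all
-- configurations being final, only the existence of a run matters.
RunsIn : ∀ {n} {Config : Set} → (Config → Fin n → List Config) → Config → List (Fin n) → Set
RunsIn succs c []      = ⊤
RunsIn succs c (f ∷ w) = ∃[ c' ] (c' ∈ succs c f × RunsIn succs c' w)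

-- If every
-- configuration satisfying an invariant (true initially, preserved by
-- steps) occurs in the finite list E, then the sets of positions in E,
-- coded as Fin (2 ^ length E), carry a partial DFA accepting the same
-- words; a transition is undefined exactly when the successor set is empty.
module SubsetConstruction
  {n : ℕ} {Config : Set} (_≟_ : DecidableEquality Config)
  (succs : Config → Fin n → List Config)
  (Inv : Config → Set)
  (inv-step : ∀ {c c' f} → Inv c → c' ∈ succs c f → Inv c')
  (E : List Config) (listed : ∀ {c} → Inv c → c ∈ E)
  (c₀ : Config) (inv-c₀ : Inv c₀)
  where

  open import Data.List.Membership.DecPropositional _≟_ using (_∈?_)

  Runs : Config → List (Fin n) → Set
  Runs = RunsIn succs

  N : ℕ
  N = length E

  State : Set
  State = Fin (2 ^ N)

  _∋_ : State → Fin N → Set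
  q ∋ k = finToFun q k ≡ 1F

  _∋?_ : ∀ q k → Dec (q ∋ k)
  q ∋? k = finToFun q k Fin.≟ 1F

  indicator : ∀ {P : Set} → Dec P → Fin 2
  indicator (yes _) = 1F
  indicator (no _)  = 0F

  setOf : {P : Fin N → Set} → (∀ k → Dec (P k)) → State
  setOf P? = funToFin (λ k → indicator (P? k))

  ∋-setOf : ∀ {P : Fin N → Set} (P? : ∀ k → Dec (P k)) k → setOf P? ∋ k ⇔ P k
  ∋-setOf P? k rewrite Fin.finToFun-funToFin (λ k → indicator (P? k)) k with P? k
  ... | yes p = mk⇔ (λ _ → p) (λ _ → refl)
  ... | no ¬p = mk⇔ (λ ()) (λ p → ⊥-elim (¬p p))

  PostAt : State → Fin n → Fin N → Set
  PostAt q f k' = ∃[ k ] (q ∋ k × lookup E k' ∈ succs (lookup E k) f)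

  post : State → Fin n → State
  post q f = setOf (λ k' → Fin.any? (λ k → (q ∋? k) ×-dec (lookup E k' ∈? succs (lookup E k) f)))

  ∋-post : ∀ q f k' → post q f ∋ k' ⇔ PostAt q f k'
  ∋-post q f = ∋-setOf _

  NonEmpty : State → Set
  NonEmpty q = ∃[ k ] (q ∋ k)

  δ : State → Fin n → Maybe State
  δ q f with Fin.any? (post q f ∋?_)
  ... | yes _ = just (post q f)
  ... | no _  = nothing

  δ-just : ∀ {q f q'} → δ q f ≡ just q' → q' ≡ post q f × NonEmpty q'
  δ-just {q} {f} eq with Fin.any? (post q f ∋?_)
  δ-just refl | yes ne = refl , ne

  δ-nonEmpty : ∀ {q f} → NonEmpty (post q f) → δ q f ≡ just (post q f)
  δ-nonEmpty {q} {f} ne with Fin.any? (post q f ∋?_)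
  ... | yes _ = refl
  ... | no ¬ne = ⊥-elim (¬ne ne)

  q₀ : State
  q₀ = setOf (λ k → lookup E k ≟ c₀)

  p₀ : c₀ ∈ E
  p₀ = listed inv-c₀

  q₀∋p₀ : q₀ ∋ index p₀
  q₀∋p₀ = Equivalence.from (∋-setOf _ _) (sym (lookup-index p₀))

  δ*-sound : ∀ q w {q'} → NonEmpty q → δ* δ q w ≡ just q' → ∃[ k ] (q ∋ k × Runs (lookup E k) w)
  δ*-sound q []      (k , q∋k) _ = k , q∋k , tt
  δ*-sound q (f ∷ w) _ eq with δ q f in δq
  ... | just q₁ with δ-just δq
  ...   | refl , ne with δ*-sound q₁ w ne eq
  ...     | k' , q₁∋k' , runs with Equivalence.to (∋-post q f k') q₁∋k'
  ...       | k , q∋k , step = k , q∋k , lookup E k' , step , runs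

  δ*-complete : ∀ q w {c} → Inv c → (p : c ∈ E) → q ∋ index p → Runs c w → ∃[ q' ] (δ* δ q w ≡ just q')
  δ*-complete q []      _ _ _ _ = q , refl
  δ*-complete q (f ∷ w) inv p q∋p (c₁ , step , runs) =
    subst (λ m → ∃[ q' ] ((m >>= λ q₁ → δ* δ q₁ w) ≡ just q'))
          (sym (δ-nonEmpty (index p₁ , post∋p₁)))
          (δ*-complete (post q f) w inv₁ p₁ post∋p₁ runs)
    where
    inv₁ : Inv c₁
    inv₁ = inv-step inv step
    p₁ : c₁ ∈ E
    p₁ = listed inv₁
    post∋p₁ : post q f ∋ index p₁
    post∋p₁ = Equivalence.from (∋-post q f (index p₁))
      (index p , q∋p , subst₂ (λ c' c → c' ∈ succs c f) (lookup-index p₁) (lookup-index p) step)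

  accepts⇔runs : ∀ w → (∃[ q ] (δ* δ q₀ w ≡ just q)) ⇔ Runs c₀ w
  accepts⇔runs w = mk⇔ sound (δ*-complete q₀ w inv-c₀ p₀ q₀∋p₀)
    where
    sound : ∃[ q ] (δ* δ q₀ w ≡ just q) → Runs c₀ w
    sound (_ , eq) with δ*-sound q₀ w (index p₀ , q₀∋p₀) eq
    ... | k , q₀∋k , runs = subst (λ c → Runs c w) (Equivalence.to (∋-setOf _ k) q₀∋k) runs

-- A configuration (r , ws) stands for the
-- language r · InStars ws: r is what remains of the current iteration
-- and ws the blocks still available (the first of which may be iterated
-- again).
module BoundedNFA {n : ℕ} where
  open BoundedLanguages {n}

  Config : Set
  Config = Word × List Word

  Lang : Config → Word → Set
  Lang (r , ws) u = ∃[ v ] (u ≡ r ++ v × InStars ws v)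

  afterLetter : Fin n → Word → List Word
  afterLetter f []       = []
  afterLetter f (f' ∷ r) with f Fin.≟ f'
  ... | yes _ = r ∷ []
  ... | no _  = []

  afterLetter-sound : ∀ {f w r} → r ∈ afterLetter f w → w ≡ f ∷ r
  afterLetter-sound {f} {f' ∷ r} m with f Fin.≟ f'
  afterLetter-sound {f} {f ∷ r} (here refl) | yes refl = refl

  afterLetter-complete : ∀ {f w r} → w ≡ f ∷ r → r ∈ afterLetter f w
  afterLetter-complete {f} refl with f Fin.≟ f
  ... | yes _  = here refl
  ... | no f≢f = ⊥-elim (f≢f refl)

  restarts : List Word → Fin n → List Config
  restarts []       f = []
  restarts (w ∷ ws) f = map (_, w ∷ ws) (afterLetter f w) ++ restarts ws f

  succs : Config → Fin n → List Config
  succs ([]     , ws) f = restarts ws f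
  succs (f' ∷ r , ws) f = map (_, ws) (afterLetter f (f' ∷ r))

  restarts-sound : ∀ {ws f c u} → c ∈ restarts ws f → Lang c u → InStars ws (f ∷ u)
  restarts-sound {w ∷ ws} {f} m L with ∈-++⁻ (map (_, w ∷ ws) (afterLetter f w)) m
  ... | inj₂ m' = cons nil (restarts-sound m' L)
  ... | inj₁ m' with ∈-map⁻ (_, w ∷ ws) m'
  ...   | r , r∈ , refl with afterLetter-sound {f} {w} r∈ | L
  ...     | refl | v , refl , I = InStars-repeat I

  restarts-complete : ∀ {ws y f x} → InStars ws y → y ≡ f ∷ x →
                      ∃[ c ] (c ∈ restarts ws f × Lang c x)
  restarts-complete nil ()
  restarts-complete (cons {u = []} _ I) eq with restarts-complete I eq
  ... | c , m , L = c , ∈-++⁺ʳ _ m , L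
  restarts-complete (cons {w} {u = f ∷ u} {v} i I) refl with InStar-head i refl
  ... | r , u' , w≡fr , refl , i' =
    (r , w ∷ _) , ∈-++⁺ˡ (∈-map⁺ (_, w ∷ _) (afterLetter-complete w≡fr)) ,
    u' ++ v , List.++-assoc r u' v , cons i' I

  succs-sound : ∀ {c c' f u} → c' ∈ succs c f → Lang c' u → Lang c (f ∷ u)
  succs-sound {[] , ws} m L = _ , refl , restarts-sound m L
  succs-sound {f' ∷ r , ws} {f = f} m L with ∈-map⁻ (_, ws) m
  ... | r' , r'∈ , refl with afterLetter-sound {f} {f' ∷ r} r'∈ | L
  ...   | refl | v , refl , I = v , refl , I

  succs-complete : ∀ {c f x} → Lang c (f ∷ x) → ∃[ c' ] (c' ∈ succs c f × Lang c' x)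
  succs-complete {[] , ws} (v , refl , I) = restarts-complete I refl
  succs-complete {f ∷ r , ws} (v , refl , I) =
    (r , ws) , ∈-map⁺ (_, ws) (afterLetter-complete refl) , v , refl , I

  Runs : Config → Word → Set
  Runs = RunsIn succs

  runs-sound : ∀ {c} w → Runs c w → ∃[ u ] Lang c (w ++ u)
  runs-sound {r , ws} [] _ = r , [] , sym (List.++-identityʳ r) , InStars-[] ws
  runs-sound (f ∷ w) (c' , m , runs) with runs-sound w runs
  ... | u , L = u , succs-sound m L

  runs-complete : ∀ {c} w {u} → Lang c (w ++ u) → Runs c w
  runs-complete []      _ = tt
  runs-complete (f ∷ w) L with succs-complete L
  ... | c' , m , L' = c' , m , runs-complete w L'

  runs⇔Pfx : ∀ W w → Runs ([] , W) w ⇔ Pfx (InStars W) w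
  runs⇔Pfx W w = mk⇔ to (λ { (u , I) → runs-complete w (w ++ u , refl , I) })
    where
    to : Runs ([] , W) w → Pfx (InStars W) w
    to runs with runs-sound w runs
    ... | u , v , refl , I = u , I

  current : List Word → Word
  current []      = []
  current (w ∷ _) = w

  Valid : List Word → Config → Set
  Valid W (r , ws) = ws ∈ suffixes W × r ∈ suffixes (current ws)

  restarts-valid : ∀ W {ws f c} → ws ∈ suffixes W → c ∈ restarts ws f → Valid W c
  restarts-valid W {w ∷ ws} {f} ws∈ m with ∈-++⁻ (map (_, w ∷ ws) (afterLetter f w)) m
  ... | inj₂ m' = restarts-valid W (suffixes-tail W ws∈) m'
  ... | inj₁ m' with ∈-map⁻ (_, w ∷ ws) m'
  ...   | r , r∈ , refl with afterLetter-sound {f} {w} r∈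
  ...     | refl = ws∈ , there (suffixes-self r)

  valid-step : ∀ W {c c' f} → Valid W c → c' ∈ succs c f → Valid W c'
  valid-step W {[] , ws} (ws∈ , _) m = restarts-valid W ws∈ m
  valid-step W {f' ∷ r , ws} {f = f} (ws∈ , r∈) m with ∈-map⁻ (_, ws) m
  ... | r' , r'∈ , refl with afterLetter-sound {f} {f' ∷ r} r'∈
  ...   | refl = ws∈ , suffixes-tail (current ws) r∈

  configs : List Word → List Config
  configs []      = ([] , []) ∷ []
  configs (w ∷ W) = map (_, w ∷ W) (suffixes w) ++ configs W

  configs-complete : ∀ W {c} → Valid W c → c ∈ configs W
  configs-complete []      (here refl , here refl) = here refl
  configs-complete (w ∷ W) (here refl , r∈) = ∈-++⁺ˡ (∈-map⁺ (_, w ∷ W) r∈)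
  configs-complete (w ∷ W) (there ws∈ , r∈) = ∈-++⁺ʳ _ (configs-complete W (ws∈ , r∈))

  config-≟ : DecidableEquality Config
  config-≟ = Pair.≡-dec (List.≡-dec Fin._≟_) (List.≡-dec (List.≡-dec Fin._≟_))

boundedAutomaton : ∀ {n} → List (List (Fin n)) → RlAutomaton n
boundedAutomaton {n} W = record
  { m = 2 ^ N ; δ = δ ; q₀ = q₀ ; words = W
  ; recognizes = λ w → ⇔.trans (accepts⇔runs w) (runs⇔Pfx W w) }
  where
  open BoundedNFA {n}
  open SubsetConstruction config-≟ succs (Valid W) (valid-step W) (configs W) (configs-complete W)
         ([] , W) (suffixes-self W , suffixes-[] (current W))

module ClosedSets {T : Set} (_≤_ : T → T → Set) where
  open Order _≤_

  closed-down : ∀ {C x y} → ScottClosed C → C x → y ≤ x → C y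
  closed-down {C} {x} {y} (U , (U-up , _) , C⇔¬U) Cx y≤x =
    Equivalence.from (C⇔¬U y) (λ Uy → Equivalence.to (C⇔¬U x) Cx (U-up y x Uy y≤x))

  closed-lub : ∀ {C D y} → ScottClosed C → (∀ d → D d → C d) → Directed D → IsLub D y → C y
  closed-lub {C} {D} {y} (U , (_ , U-inacc) , C⇔¬U) D⊆C D-dir y-lub =
    Equivalence.from (C⇔¬U y) λ Uy →
      let (d , Dd , Ud) = U-inacc D D-dir y y-lub Uy in Equivalence.to (C⇔¬U d) (D⊆C d Dd) Ud

  closed-stable : ∀ {C x} → ScottClosed C → ¬ ¬ C x → C x
  closed-stable {C} {x} (U , _ , C⇔¬U) ¬¬Cx =
    Equivalence.from (C⇔¬U x) (λ Ux → ¬¬Cx (λ Cx → Equivalence.to (C⇔¬U x) Cx Ux))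

  complement-closed : ∀ {U} → ScottOpen U → ScottClosed (λ x → ¬ U x)
  complement-closed {U} U-open = U , U-open , λ _ → mk⇔ id id

  cl-sub : ∀ {ℓ} {X : T → Set ℓ} {x} → X x → cl X x
  cl-sub Xx C _ X⊆C = X⊆C _ Xx

  cl-idem : ∀ {ℓ ℓ'} {X : T → Set ℓ} {Y : T → Set ℓ'} →
            (∀ x → X x → cl Y x) → ∀ x → cl X x → cl Y x
  cl-idem X⊆clY x clXx C C-closed Y⊆C = clXx C C-closed (λ y Xy → X⊆clY y Xy C C-closed Y⊆C)

  cl-mono : ∀ {ℓ ℓ'} {X : T → Set ℓ} {Y : T → Set ℓ'} → (∀ x → X x → Y x) → ∀ x → cl X x → cl Y x
  cl-mono X⊆Y = cl-idem (λ y Xy → cl-sub (X⊆Y y Xy))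

  cl-down : ∀ {ℓ} {X : T → Set ℓ} {x y} → cl X x → y ≤ x → cl X y
  cl-down clXx y≤x C C-closed X⊆C = closed-down C-closed (clXx C C-closed X⊆C) y≤x

module DirectedSets {T : Set} {_≤_ : T → T → Set}
  (≤-refl : ∀ {x} → x ≤ x) (≤-trans : ∀ {x y z} → x ≤ y → y ≤ z → x ≤ z) where
  open Order _≤_

  Above : (T → Set) → T → T → Set
  Above D d₀ d = D d × d₀ ≤ d

  above-directed : ∀ {D d₀} → Directed D → D d₀ → Directed (Above D d₀)
  above-directed (_ , D-dir) Dd₀ =
    (_ , Dd₀ , ≤-refl) ,
    λ a b (Da , d₀≤a) (Db , _) → let (c , Dc , a≤c , b≤c) = D-dir a b Da Db in
      c , (Dc , ≤-trans d₀≤a a≤c) , a≤c , b≤c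

  above-lub : ∀ {D d₀ z} → Directed D → D d₀ → IsLub D z → IsLub (Above D d₀) z
  above-lub {D} {d₀} (_ , D-dir) Dd₀ (z-ub , z-least) =
    (λ d (Dd , _) → z-ub d Dd) ,
    λ u u-ub → z-least u λ d Dd → let (c , Dc , d≤c , d₀≤c) = D-dir d d₀ Dd Dd₀ in
      ≤-trans d≤c (u-ub c (Dc , d₀≤c))

  increasing-mono : (Z : ℕ → T) → (∀ k → Z k ≤ Z (suc k)) → ∀ {i j} → i ≤′ j → Z i ≤ Z j
  increasing-mono Z Z-inc ≤′-refl       = ≤-refl
  increasing-mono Z Z-inc (≤′-step i≤j) = ≤-trans (increasing-mono Z Z-inc i≤j) (Z-inc _)

  increasing-directed : (Z : ℕ → T) → (∀ k → Z k ≤ Z (suc k)) →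
                        (D : T → Set) → (∀ z → D z ⇔ (∃[ k ] (Z k ≡ z))) → Directed D
  increasing-directed Z Z-inc D D⇔range =
    (Z 0 , Equivalence.from (D⇔range (Z 0)) (0 , refl)) ,
    λ x y Dx Dy → upper (Equivalence.to (D⇔range x) Dx) (Equivalence.to (D⇔range y) Dy)
    where
    upper : ∀ {x y} → ∃[ i ] (Z i ≡ x) → ∃[ j ] (Z j ≡ y) → ∃[ z ] (D z × x ≤ z × y ≤ z)
    upper (i , refl) (j , refl) =
      Z (i ⊔ j) , Equivalence.from (D⇔range _) (i ⊔ j , refl) ,
      increasing-mono Z Z-inc (ℕ.≤⇒≤′ (ℕ.m≤m⊔n i j)) , increasing-mono Z Z-inc (ℕ.≤⇒≤′ (ℕ.m≤n⊔m i j))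

bind-just : ∀ {A B : Set} (m : Maybe A) {k : A → Maybe B} {b} → (m >>= k) ≡ just b →
            ∃[ a ] (m ≡ just a × k a ≡ just b)
bind-just (just a) e = a , refl , e

module Words {T : Set} (_≤_ : T → T → Set) {n : ℕ} (step : Fin n → T → Maybe T) where
  open Trans _≤_ step

  stepW-++ : ∀ u v x → stepW (u ++ v) x ≡ (stepW u x >>= stepW v)
  stepW-++ []      v x = refl
  stepW-++ (f ∷ u) v x with step f x
  ... | just x₁ = stepW-++ u v x₁
  ... | nothing = refl

  poststar-stepW : ∀ {ℓ} {A : T → Set ℓ} u {x y} → PostStar A x → stepW u x ≡ just y → PostStar A y
  poststar-stepW []      reach refl = reach
  poststar-stepW (f ∷ u) {x} reach e with bind-just (step f x) e
  ... | x₁ , e₁ , e₂ = poststar-stepW u (next f reach e₁) e₂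

module WSTS (𝔖 : CompleteWSTS) where
  open CompleteWSTS 𝔖
  open ClosedSets _≤_
  open Words _≤_ step
  open BoundedLanguages {n} using (Word; pow; pow-suc)

  ≤-refl : ∀ {x} → x ≤ x
  ≤-refl = IsPartialOrder.refl isPartialOrder

  ≤-trans : ∀ {x y z} → x ≤ y → y ≤ z → x ≤ z
  ≤-trans = IsPartialOrder.trans isPartialOrder

  open DirectedSets {_≤_ = _≤_} ≤-refl ≤-trans

  dom-upward : ∀ f {x x' y} → x ≤ x' → step f x ≡ just y → ∃[ y' ] (step f x' ≡ just y')
  dom-upward f {x} {x'} {y} x≤x' e = proj₁ (domOpen f) x x' (y , e) x≤x'

  -- continuous maps are monotone: x' is the supremum of the directed set {x , x'}
  step-mono : ∀ f {x x' y y'} → x ≤ x' → step f x ≡ just y → step f x' ≡ just y' → y ≤ y'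
  step-mono f {x} {x'} {y} {y'} x≤x' e e' with stepCont f Pair pair-directed pair-dom x' pair-lub
    where
    Pair : S → Set
    Pair d = d ≡ x ⊎ d ≡ x'
    pair-ub : ∀ d → Pair d → d ≤ x'
    pair-ub _ (inj₁ refl) = x≤x'
    pair-ub _ (inj₂ refl) = ≤-refl
    pair-directed : Directed Pair
    pair-directed = (x , inj₁ refl) , λ a b Pa Pb → x' , inj₂ refl , pair-ub a Pa , pair-ub b Pb
    pair-dom : ∀ d → Pair d → ∃[ z ] (step f d ≡ just z)
    pair-dom _ (inj₁ refl) = y , e
    pair-dom _ (inj₂ refl) = y' , e'
    pair-lub : IsLub Pair x'
    pair-lub = pair-ub , λ u u-ub → u-ub x' (inj₂ refl)
  ... | _ , e'' , (image-ub , _) =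
    subst (y ≤_) (just-injective (trans (sym e'') e')) (image-ub y (x , inj₁ refl , e))

  stepW-compat : ∀ w {x x' y} → x ≤ x' → stepW w x ≡ just y → ∃[ y' ] (stepW w x' ≡ just y' × y ≤ y')
  stepW-compat []      {x' = x'} x≤x' refl = x' , refl , x≤x'
  stepW-compat (f ∷ w) {x} x≤x' e with bind-just (step f x) e
  ... | x₁ , e₁ , e₂ with dom-upward f x≤x' e₁
  ...   | x₁' , e₁' with stepW-compat w (step-mono f x≤x' e₁ e₁') e₂
  ...     | y' , e₂' , y≤y' = y' , subst (λ m → (m >>= stepW w) ≡ just y') (sym e₁') e₂' , y≤y'

  image-directed : ∀ f {D : S → Set} → Directed D → (∀ d → D d → ∃[ y ] (step f d ≡ just y)) →
                   Directed (λ y → ∃[ d ] (D d × step f d ≡ just y))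
  image-directed f ((d₀ , Dd₀) , D-dir) D⊆dom =
    (_ , d₀ , Dd₀ , proj₂ (D⊆dom d₀ Dd₀)) ,
    λ { _ _ (a , Da , ea) (b , Db , eb) →
      let (c , Dc , a≤c , b≤c) = D-dir a b Da Db
          (fc , ec) = D⊆dom c Dc
      in fc , (c , Dc , ec) , step-mono f a≤c ea ec , step-mono f b≤c eb ec }

  Preimage : Fin n → (S → Set) → S → Set
  Preimage f U x = ∃[ y ] (step f x ≡ just y × U y)

  -- On a directed subset of dom f, f preserves the supremum, so the
  -- preimage of an open set cannot be reached by the supremum alone.
  preimage-inacc-in-dom : ∀ f {U D z y} → ScottOpen U → Directed D →
                          (∀ d → D d → ∃[ y ] (step f d ≡ just y)) → IsLub D z →
                          step f z ≡ just y → U y → ∃[ d ] (D d × Preimage f U d)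
  preimage-inacc-in-dom f {U} (_ , U-inacc) D-dir D⊆dom z-lub e Uy
    with stepCont f _ D-dir D⊆dom _ z-lub
  ... | y' , e' , y'-lub
    with U-inacc _ (image-directed f D-dir D⊆dom) y' y'-lub (subst U (just-injective (trans (sym e) e')) Uy)
  ... | u , (d , Dd , eu) , Uu = d , Dd , u , eu , Uu

  -- Continuity: preimages of Scott-open sets are Scott-open.  A directed
  -- set is first cut down to its part above an element of dom f.
  preimage-open : ∀ f {U} → ScottOpen U → ScottOpen (Preimage f U)
  preimage-open f {U} U-open@(U-up , _) = up , inacc
    where
    up : ∀ x x' → Preimage f U x → x ≤ x' → Preimage f U x'
    up x x' (y , e , Uy) x≤x' =
      let (y' , e') = dom-upward f x≤x' e in y' , e' , U-up y y' Uy (step-mono f x≤x' e e')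
    inacc : ∀ D → Directed D → ∀ z → IsLub D z → Preimage f U z → ∃[ d ] (D d × Preimage f U d)
    inacc D D-dir z z-lub (y , e , Uy) with proj₂ (domOpen f) D D-dir z z-lub (y , e)
    ... | d₀ , Dd₀ , (_ , e₀) with preimage-inacc-in-dom f U-open (above-directed D-dir Dd₀)
                                    (λ d (_ , d₀≤d) → dom-upward f d₀≤d e₀)
                                    (above-lub D-dir Dd₀ z-lub) e Uy
    ...   | d , (Dd , _) , fd∈U = d , Dd , fd∈U

  -- Continuous maps send the closure of X into the closure of any Y
  -- containing f[X]: the complement of f⁻¹(S ∖ C) is closed and contains X.
  cl-step : ∀ f {ℓ ℓ'} {X : S → Set ℓ} {Y : S → Set ℓ'} {x y} →
            (∀ {x' y'} → X x' → step f x' ≡ just y' → Y y') →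
            cl X x → step f x ≡ just y → cl Y y
  cl-step f {X = X} {x = x} {y} X→Y clXx e C (U , U-open , C⇔¬U) Y⊆C =
    Equivalence.from (C⇔¬U y) λ Uy →
      clXx _ (complement-closed (preimage-open f U-open)) X⊆C' (y , e , Uy)
    where
    X⊆C' : ∀ x' → X x' → ¬ Preimage f U x'
    X⊆C' x' Xx' (y' , e' , Uy') = Equivalence.to (C⇔¬U y') (Y⊆C y' (X→Y Xx' e')) Uy'

  cl-stepW : ∀ w {ℓ ℓ'} {X : S → Set ℓ} {Y : S → Set ℓ'} {x y} →
             (∀ {x' y'} → X x' → stepW w x' ≡ just y' → Y y') →
             cl X x → stepW w x ≡ just y → cl Y y
  cl-stepW []      X→Y clXx refl = cl-mono (λ x' Xx' → X→Y Xx' refl) _ clXx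
  cl-stepW (f ∷ w) {X = X} {Y} {x} X→Y clXx e with bind-just (step f x) e
  ... | x₁ , e₁ , e₂ = cl-stepW w after-f (cl-step f (λ Xx' e' → _ , Xx' , e') clXx e₁) e₂
    where
    after-f : ∀ {x₁' y'} → ∃[ x' ] (X x' × step f x' ≡ just x₁') → stepW w x₁' ≡ just y' → Y y'
    after-f {y' = y'} (x' , Xx' , e') e'' = X→Y Xx' (subst (λ m → (m >>= stepW w) ≡ just y') (sym e') e'')

  Orbit : Word → S → S → Set
  Orbit g x z = ∃[ k ] (stepW (pow g k) x ≡ just z)

  -- If x ≤ g(x), the orbit of x is an increasing chain, hence directed:
  -- by compatibility, z ≤ g(z) propagates from z to g(z).
  module AscendingOrbit (g : Word) {x gx : S} (eg : stepW g x ≡ just gx) (x≤gx : x ≤ gx) where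

    Ascending : S → Set
    Ascending z = ∃[ z' ] (stepW g z ≡ just z' × z ≤ z')

    orbit : ℕ → ∃ Ascending
    orbit zero    = x , gx , eg , x≤gx
    orbit (suc k) =
      let (z , z' , e , z≤z') = orbit k
          (z'' , e' , z'≤z'') = stepW-compat g z≤z' e
      in z' , z'' , e' , z'≤z''

    Z : ℕ → S
    Z k = proj₁ (orbit k)

    Z-increasing : ∀ k → Z k ≤ Z (suc k)
    Z-increasing k = proj₂ (proj₂ (proj₂ (orbit k)))

    Z-stepW : ∀ k → stepW (pow g k) x ≡ just (Z k)
    Z-stepW zero    = refl
    Z-stepW (suc k) = begin
      stepW (pow g (suc k)) x           ≡⟨ cong (λ u → stepW u x) (pow-suc g k) ⟩
      stepW (pow g k ++ g) x            ≡⟨ stepW-++ (pow g k) g x ⟩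
      (stepW (pow g k) x >>= stepW g)   ≡⟨ cong (_>>= stepW g) (Z-stepW k) ⟩
      stepW g (Z k)                     ≡⟨ proj₁ (proj₂ (proj₂ (orbit k))) ⟩
      just (Z (suc k))                  ∎
      where open ≡-Reasoning

    orbit-directed : Directed (Orbit g x)
    orbit-directed = increasing-directed Z Z-increasing (Orbit g x) λ z → mk⇔
      (λ (k , e) → k , just-injective (trans (sym (Z-stepW k)) e))
      (λ { (k , refl) → k , Z-stepW k })

  -- Acceleration stays inside every closed set containing the orbit:
  -- g^∞(a) is either g(a) or the supremum of the directed orbit.
  accel-closed : ∀ {C g a y} → ScottClosed C → (∀ k {z} → stepW (pow g k) a ≡ just z → C z) →
                 Accel g a y → C y
  accel-closed {C} {g} {a} {y} C-closed orbit⊆C (gx , eg , lub-case , eq-case) =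
    closed-stable C-closed λ ¬Cy → ¬Cy (subst C (sym (eq-case (λ a⊏gx → ¬Cy (limit a⊏gx)))) Cgx)
    where
    limit : a ⊏ gx → C y
    limit a⊏gx = closed-lub C-closed (λ z (k , e) → orbit⊆C k e)
      (AscendingOrbit.orbit-directed g eg (proj₁ a⊏gx)) (lub-case a⊏gx)
    Cgx : C gx
    Cgx = orbit⊆C 1 (trans (cong (λ u → stepW u a) (List.++-identityʳ g)) eg)

  accel-cl : ∀ {ℓ} {Y : S → Set ℓ} {g a y} → (∀ k {z} → stepW (pow g k) a ≡ just z → cl Y z) →
             Accel g a y → cl Y y
  accel-cl orbit⊆clY acc C C-closed Y⊆C = accel-closed C-closed (λ k e → orbit⊆clY k e C C-closed Y⊆C) acc

  cover-below : ∀ {ℓ} {A : S → Set ℓ} {s₀} → A s₀ → Post A ≤♭ A → ∀ x → Cover s₀ x → Down A x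
  cover-below {A = A} {s₀} As₀ post≤♭A x (x' , reach , x≤x') =
    let (a , Aa , x'≤a) = below x' reach in a , Aa , ≤-trans x≤x' x'≤a
    where
    below : ∀ x → PostStar (Down (_≡ s₀)) x → Down A x
    below x (base (_ , refl , x≤s₀)) = s₀ , As₀ , x≤s₀
    below y (next {x = x} f reach e) with below x reach
    ... | a , Aa , x≤a with dom-upward f x≤a e
    ...   | y' , e' = post≤♭A y (y' , (f , a , Aa , e') , step-mono f x≤a e e')

module CloverInvariant (𝔖 : CompleteWSTS) (s₀ : CompleteWSTS.S 𝔖) where
  open CompleteWSTS 𝔖
  open ClosedSets _≤_
  open WSTS 𝔖
  open BoundedLanguages {n}

  Reach : List Word → S → Set
  Reach W s = ∃[ u ] (InStars W u × stepW u s₀ ≡ just s)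

  Reach-extend : ∀ W {g w x z} → InStar g w → Reach W x → stepW w x ≡ just z → Reach (W ++ g ∷ []) z
  Reach-extend W {g} {w} {z = z} i (u , I , e) e' =
    u ++ w , InStars-++ I (subst (InStars (g ∷ [])) (List.++-identityʳ w) (cons i nil)) ,
    trans (Words.stepW-++ _≤_ step u w s₀) (subst (λ m → (m >>= stepW w) ≡ just z) (sym e) e')

  acceleratedWords : ∀ {A} → CloverRun 𝔖 s₀ A → List Word
  acceleratedWords start                   = []
  acceleratedWords (extend run _ g _ _ _ _) = acceleratedWords run ++ g ∷ []

  clover-invariant : ∀ {A} (run : CloverRun 𝔖 s₀ A) {a} → a ∈ A → cl (Reach (acceleratedWords run)) a
  clover-invariant start (here refl) = cl-sub ([] , nil , refl)
  clover-invariant (extend run _ g _ _ _ _) (there a∈A) =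
    cl-mono (λ _ Rx → Reach-extend (acceleratedWords run) nil Rx refl) _ (clover-invariant run a∈A)
  clover-invariant (extend run _ g a _ a∈A acc) (here refl) =
    accel-cl (λ k → cl-stepW (pow g k) (Reach-extend (acceleratedWords run) (InStar-pow g k))
                             (clover-invariant run a∈A)) acc

  s₀∈ : ∀ {A} → CloverRun 𝔖 s₀ A → s₀ ∈ A
  s₀∈ start                  = here refl
  s₀∈ (extend run _ _ _ _ _ _) = there (s₀∈ run)

module ProductFacts (𝔖 : CompleteWSTS) (𝒜 : RlAutomaton (CompleteWSTS.n 𝔖)) where
  open CompleteWSTS 𝔖
  open RlAutomaton 𝒜
  open Product 𝔖 𝒜
  open WSTS 𝔖 using (≤-refl)
  open Trans _≤×_ step× using () renaming (stepW to stepW×; PostStar to PostStar×; base to base×; next to next×)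
  open Order _≤×_ using () renaming (Down to Down×; ScottClosed to ScottClosed×; Directed to Directed×; IsLub to IsLub×)

  stepW×-pair : ∀ u {s s' q q'} → stepW u s ≡ just s' → δ* δ q u ≡ just q' → stepW× u (s , q) ≡ just (s' , q')
  stepW×-pair []      refl refl = refl
  stepW×-pair (f ∷ u) {s} {q = q} e e' with bind-just (step f s) e | bind-just (δ q f) e'
  ... | s₁ , es₁ , e₂ | q₁ , eq₁ , e₂' rewrite es₁ | eq₁ = stepW×-pair u e₂ e₂'

  accepted-cover : ∀ {s₀} u {s q} → stepW u s₀ ≡ just s → δ* δ q₀ u ≡ just q → Cover× (s₀ , q₀) (s , q)
  accepted-cover u e e' =
    _ , Words.poststar-stepW _≤×_ step× u (base× ((_ , q₀) , refl , ≤-refl , refl)) (stepW×-pair u e e') , ≤-refl , refl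

  step×-fst : ∀ f {s q s' q'} → step× f (s , q) ≡ just (s' , q') → step f s ≡ just s'
  step×-fst f {s} {q} e with step f s | δ q f
  step×-fst f refl | just _ | just _ = refl

  cover-fst : ∀ {s₀ s q} → Cover× (s₀ , q₀) (s , q) → Cover s₀ s
  cover-fst {s₀} ((x , _) , reach , x≤s , _) = x , fst-reach reach , x≤s
    where
    fst-reach : ∀ {p} → PostStar× (Down× (_≡ (s₀ , q₀))) p → PostStar (Down (_≡ s₀)) (proj₁ p)
    fst-reach (base× (_ , refl , p≤ , _)) = base (_ , refl , p≤)
    fst-reach (next× f reach e)          = next f (fst-reach reach) (step×-fst f e)

  -- Closed sets pull back to closed sets along the first projection: a
  -- directed set of pairs projects to a directed set with the projected
  -- supremum.
  fst-closed : ∀ {C} → ScottClosed C → ScottClosed× (λ p → C (proj₁ p))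
  fst-closed {C} (U , (U-up , U-inacc) , C⇔¬U) = (λ p → U (proj₁ p)) , (up , inacc) , (λ p → C⇔¬U (proj₁ p))
    where
    up : ∀ p p' → U (proj₁ p) → p ≤× p' → U (proj₁ p')
    up (s , _) (s' , _) Us (s≤s' , _) = U-up s s' Us s≤s'
    inacc : ∀ D → Directed× D → ∀ z → IsLub× D z → U (proj₁ z) → ∃[ d ] (D d × U (proj₁ d))
    inacc D ((d₀ , Dd₀) , D-dir) (zs , zq) (z-ub , z-least) Uz
      with U-inacc Fst Fst-directed zs Fst-lub Uz
      where
      Fst : S → Set
      Fst s = ∃[ q ] D (s , q)
      Fst-directed : Directed Fst
      Fst-directed = (proj₁ d₀ , proj₂ d₀ , Dd₀) , λ { a b (qa , Da) (qb , Db) →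
        let ((c , qc) , Dc , (a≤c , _) , (b≤c , _)) = D-dir (a , qa) (b , qb) Da Db in
        c , (qc , Dc) , a≤c , b≤c }
      Fst-lub : IsLub Fst zs
      Fst-lub = (λ { d (q , Dd) → proj₁ (z-ub (d , q) Dd) }) ,
                λ u u-ub → proj₁ (z-least (u , zq) (λ { (d , q) Dd → u-ub d (q , Dd) , proj₂ (z-ub (d , q) Dd) }))
    ... | d , (q , Dd) , Ud = (d , q) , Dd , Ud

  cl-fst : ∀ {ℓ ℓ'} {Y : S × Fin m → Set ℓ} {Z : S → Set ℓ'} {s q} →
           (∀ {s' q'} → Y (s' , q') → Z s') → cl× Y (s , q) → cl Z s
  cl-fst Y→Z clY C C-closed Z⊆C = clY _ (fst-closed C-closed) (λ { (s' , q') Ys' → Z⊆C s' (Y→Z Ys') })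

-- ∞-effectiveness only makes Clover executable; the argument does not use it.
proposition5p18 : (𝔖 : CompleteWSTS) → InfEffective 𝔖 →
    (s₀ : CompleteWSTS.S 𝔖) → CloverTerminates 𝔖 s₀ → StronglyCloverFlattable 𝔖 s₀
proposition5p18 𝔖 _ s₀ (A , run , post≤♭A) = 𝒜 , cover⊆projected , projected⊆cover
  where
  open CompleteWSTS 𝔖
  open ClosedSets _≤_
  open WSTS 𝔖 using (cover-below)
  open CloverInvariant 𝔖 s₀
  open BoundedLanguages {n} using (Word)

  W : List Word
  W = acceleratedWords run

  𝒜 : RlAutomaton n
  𝒜 = boundedAutomaton W

  open RlAutomaton 𝒜
  open Product 𝔖 𝒜
  open ProductFacts 𝔖 𝒜
  open ClosedSets _≤×_ using () renaming (cl-sub to cl×-sub)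

  ProjectedCover : S → Set₁
  ProjectedCover s = ∃[ q ] cl× (Cover× (s₀ , q₀)) (s , q)

  -- a word of w₁* ⋯ wₖ* is accepted by 𝒜, so it also runs in the product
  reach-projected : ∀ s → Reach W s → ProjectedCover s
  reach-projected s (u , I , e) with Equivalence.from (recognizes u) ([] , subst (InStars W) (sym (List.++-identityʳ u)) I)
  ... | q , eδ = q , cl×-sub (accepted-cover u e eδ)

  -- Cover(s₀) ⊆ ↓A, and A ⊆ cl(Reach W) by the Clover invariant
  cover⊆projected : ∀ s → cl (Cover s₀) s → cl ProjectedCover s
  cover⊆projected = cl-idem λ s cov →
    let (a , a∈A , s≤a) = cover-below (s₀∈ run) post≤♭A s cov
    in cl-down (cl-mono reach-projected a (clover-invariant run a∈A)) s≤a

  -- Cover_{𝔖×𝒜} projects into Cover(s₀), and closures follow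
  projected⊆cover : ∀ s → cl ProjectedCover s → cl (Cover s₀) s
  projected⊆cover = cl-idem λ s (q , cl-cover×) → cl-fst cover-fst cl-cover×
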